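{- Let $m\ge2$ and $\mathcal{P}_m=\{\sigma\in S_m:|\sigma(i)-i|\le1\text{ for all }i\in\{0,\dots,m-1\}\}$. Let $\rho$ be a $\{0,1\}$-coloring of the positions $\{(i,j):|i-j|\le1\}$, let $t$ be an integer, and let $F=\{\sigma\in\mathcal{P}_m:\sum_i\rho(i,\sigma(i))=t\}$ be nonempty. Set $F_0=\{\sigma\in F:\sigma(0)=0\}$ and $F_1=\{\sigma\in F:\sigma(0)=1\}$. Let $F_0'=\{\tau:\tau(j)=\sigma(j+1)-1,\ \sigma\in F_0\}$ (permutations of $\{0,\dots,m-2\}$) and $F_1'=\{\tau:\tau(j)=\sigma(j+2)-2,\ \sigma\in F_1\}$ (permutations of $\{0,\dots,m-3\}$). Then \[P_F(\lambda)=\Bigl(\prod_{i=1}^{m-1}(\lambda+i)\Bigr)P_{F_0'}(\lambda+1)-\lambda\Bigl(\prod_{i=2}^{m-1}(\lambda+i)^2\Bigr)P_{F_1'}(\lambda+2).\]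
   Context: $S_k$ is the set of permutations of $\{0,\dots,k-1\}$. For a set $S$ of permutations of $\{0,\dots,k-1\}$, $P_S(\lambda)=\sum_{\sigma\in S}\operatorname{sgn}(\sigma)\prod_{i=0}^{k-1}(\lambda+i)^{\sigma(i)}$; the empty family has $P=0$, and the family consisting of the empty permutation (when $k=0$) has $P=1$. -}

module Defs where

open import Data.Nat as ℕ using (ℕ; zero; suc; _∸_; _≡ᵇ_; _<ᵇ_)
open import Data.Fin as Fin using (Fin; zero; suc; toℕ)
open import Data.Fin.Properties as FinP using ()
open import Data.Bool using (Bool; true; false; _∧_; _∨_; not; if_then_else_)
open import Data.List using (List; []; _∷_; [_]; map; concatMap; filterᵇ; foldr; upTo; allFin)
open import Data.Bool.ListAction using (all; any)
open import Data.Nat.ListAction using (sum)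
open import Data.Integer as ℤ using (ℤ; +_; _*_; _+_; -_; _^_)
open import Relation.Nullary.Decidable using (⌊_⌋)

Fun : ℕ → Set
Fun k = Fin k → Fin k

cons : ∀ {n k} → Fin k → (Fin n → Fin k) → Fin (suc n) → Fin k
cons a f zero    = a
cons a f (suc i) = f i

allFuns : (n k : ℕ) → List (Fin n → Fin k)
allFuns zero    k = [ (λ ()) ]
allFuns (suc n) k = concatMap (λ f → map (λ a → cons a f) (allFin k)) (allFuns n k)

isPerm : ∀ {k} → Fun k → Bool
isPerm {k} σ = all (λ i → all (λ j → not ⌊ σ i Fin.≟ σ j ⌋ ∨ ⌊ i Fin.≟ j ⌋) (allFin k)) (allFin k)

perms : (k : ℕ) → List (Fun k)
perms k = filterᵇ isPerm (allFuns k k)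

inversions : ∀ {k} → Fun k → ℕ
inversions {k} σ = sum (map (λ i → sum (map (λ j →
  if (toℕ i <ᵇ toℕ j) ∧ (toℕ (σ j) <ᵇ toℕ (σ i)) then 1 else 0) (allFin k))) (allFin k))

sgn : ∀ {k} → Fun k → ℤ
sgn σ = (- (+ 1)) ^ inversions σ

Family : ℕ → Set
Family k = Fun k → Bool

-- product over i ∈ {a,…,b} (empty if b < a)
∏[_⋯_] : ℕ → ℕ → (ℕ → ℤ) → ℤ
∏[ a ⋯ b ] f = foldr (λ i r → f i * r) (+ 1) (map (a ℕ.+_) (upTo (suc b ∸ a)))

P : (k : ℕ) → Family k → ℤ → ℤ
P k S x = foldr _+_ (+ 0) (map (λ σ → sgn σ * foldr (λ i r → (x + + toℕ i) ^ toℕ (σ i) * r) (+ 1) (allFin k))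
                              (filterᵇ S (perms k)))

banded : ∀ {m} → Fun m → Bool
banded {m} σ = all (λ i → ℕ.∣ toℕ (σ i) - toℕ i ∣ ℕ.≤ᵇ 1) (allFin m)
  where open import Data.Nat using (∣_-_∣)

weight : ∀ {m} → (Fin m → Fin m → Fin 2) → Fun m → ℕ
weight {m} ρ σ = sum (map (λ i → toℕ (ρ i (σ i))) (allFin m))

-- F = {σ ∈ P_m : Σ_i ρ(i,σ(i)) = t}   (σ is required to be a permutation separately)
F : ∀ {m} → (Fin m → Fin m → Fin 2) → ℤ → Family m
F ρ t σ = banded σ ∧ ⌊ + weight ρ σ ℤ.≟ t ⌋

F₀ : ∀ n → (Fin (suc (suc n)) → Fin (suc (suc n)) → Fin 2) → ℤ → Family (suc (suc n))
F₀ n ρ t σ = isPerm σ ∧ F ρ t σ ∧ (toℕ (σ zero) ≡ᵇ 0)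

F₁ : ∀ n → (Fin (suc (suc n)) → Fin (suc (suc n)) → Fin 2) → ℤ → Family (suc (suc n))
F₁ n ρ t σ = isPerm σ ∧ F ρ t σ ∧ (toℕ (σ zero) ≡ᵇ 1)

F₀' : ∀ n → (Fin (suc (suc n)) → Fin (suc (suc n)) → Fin 2) → ℤ → Family (suc n)
F₀' n ρ t τ = any (λ σ → F₀ n ρ t σ ∧ all (λ j → toℕ (τ j) ≡ᵇ (toℕ (σ (suc j)) ∸ 1)) (allFin (suc n)))
                  (perms (suc (suc n)))

F₁' : ∀ n → (Fin (suc (suc n)) → Fin (suc (suc n)) → Fin 2) → ℤ → Family n
F₁' n ρ t τ = any (λ σ → F₁ n ρ t σ ∧ all (λ j → toℕ (τ j) ≡ᵇ (toℕ (σ (suc (suc j))) ∸ 2)) (allFin n))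
                  (perms (suc (suc n)))

-- A banded permutation σ has σ(0) ∈ {0, 1}, which splits F into F₀ and F₁.  If σ(0) = 0 then
-- σ = 0 ⊕ (τ + 1) with τ ∈ F₀'; σ has the inversions of τ, and its monomial at λ is ∏_{i≥1} (λ + i)
-- times the monomial of τ at λ + 1.  If σ(0) = 1, then 0 still has a preimage under σ, which by
-- bandedness can only be 1; so σ = (0 1)(τ + 2) with τ ∈ F₁', which costs one inversion, and the
-- monomial of σ at λ is λ ∏_{i≥2} (λ + i)² times that of τ at λ + 2.

{-# OPTIONS --safe #-}
module Submission where

open import Defs
open import Data.Nat as ℕ using (ℕ; zero; suc; _≡ᵇ_; _<ᵇ_; _∸_)
import Data.Nat.Properties as ℕP
open import Data.Nat.ListAction using (sum)
open import Data.Fin as Fin using (Fin; zero; suc; toℕ; punchOut)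
import Data.Fin.Properties as FinP
open import Data.Bool using (Bool; true; false; T; _∧_; _∨_; not; if_then_else_)
open import Data.Bool.Properties using (T-∧)
open import Data.Bool.ListAction using (and; all; any)
open import Data.List using (List; []; _∷_; _++_; map; concatMap; filterᵇ; foldr; tabulate; allFin;
                              applyUpTo)
open import Data.List.Properties using (map-cong; map-∘; map-tabulate; map-upTo; foldr-map; foldr-cong)
open import Data.List.Relation.Unary.Any as Any using (Any; here)
import Data.List.Relation.Unary.Any.Properties as Anyₚ
import Data.List.Relation.Unary.All.Properties as Allₚ
open import Data.List.Membership.Propositional using (find; lose)
open import Data.List.Membership.Propositional.Properties using (∈-filter⁺; ∈-filter⁻)
open import Data.Integer as ℤ using (ℤ; +_; _+_; _-_; _*_; _^_; -_)
import Data.Integer.Properties as ℤP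
open import Data.Product using (Σ; ∃-syntax; _×_; _,_; proj₁; proj₂)
open import Data.Sum using (_⊎_; inj₁; inj₂; reduce)
open import Data.Empty using (⊥-elim)
open import Function using (_∘_; id; _⇔_; mk⇔; Equivalence; Injective)
open import Relation.Binary.PropositionalEquality
open import Relation.Nullary using (¬_; Dec; yes; no; contradiction)
open import Relation.Nullary.Decidable using (⌊_⌋; T?)

open Equivalence using (to; from)
import Algebra.Properties.CommutativeSemigroup ℤP.+-commutativeSemigroup as +-CS
import Algebra.Properties.CommutativeSemigroup ℤP.*-commutativeSemigroup as *-CS

𝟙 : Bool → ℤ
𝟙 true  = + 1
𝟙 false = + 0

𝟙-∧ : ∀ a b → 𝟙 (a ∧ b) ≡ 𝟙 a * 𝟙 b
𝟙-∧ true  b = sym (ℤP.*-identityˡ (𝟙 b))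
𝟙-∧ false b = refl

𝟙-*-vanishes : ∀ {b} {P : Set} y → (T b → P) → ¬ P → 𝟙 b * y ≡ + 0
𝟙-*-vanishes {true}  y b⇒P ¬P = contradiction (b⇒P _) ¬P
𝟙-*-vanishes {false} y _   _  = refl

T-⇔→≡ : ∀ {a b} → (T a ⇔ T b) → a ≡ b
T-⇔→≡ {false} {false} _ = refl
T-⇔→≡ {false} {true}  e = ⊥-elim (from e _)
T-⇔→≡ {true}  {false} e = ⊥-elim (to e _)
T-⇔→≡ {true}  {true}  _ = refl

T-all-allFin : ∀ {k} (p : Fin k → Bool) → T (all p (allFin k)) ⇔ (∀ i → T (p i))
T-all-allFin p = mk⇔ (Allₚ.tabulate⁻ ∘ Allₚ.all⁺ p _) (Allₚ.all⁻ p ∘ Allₚ.tabulate⁺)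

T-implies : ∀ {P Q : Set} (P? : Dec P) (Q? : Dec Q) → T (not ⌊ P? ⌋ ∨ ⌊ Q? ⌋) ⇔ (P → Q)
T-implies (yes _) (yes q) = mk⇔ (λ _ _ → q) _
T-implies (yes p) (no ¬q) = mk⇔ (λ ()) (λ p⇒q → ¬q (p⇒q p))
T-implies (no ¬p) _       = mk⇔ (λ _ p → contradiction p ¬p) _

private variable
  A B : Set

∑ : List A → (A → ℤ) → ℤ
∑ xs f = foldr _+_ (+ 0) (map f xs)

∑-cong : ∀ (xs : List A) {f g} → f ≗ g → ∑ xs f ≡ ∑ xs g
∑-cong xs f≗g = cong (foldr _+_ (+ 0)) (map-cong f≗g xs)

∑-++ : ∀ (xs ys : List A) f → ∑ (xs ++ ys) f ≡ ∑ xs f + ∑ ys f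
∑-++ []       ys f = sym (ℤP.+-identityˡ _)
∑-++ (x ∷ xs) ys f = trans (cong (_+_ (f x)) (∑-++ xs ys f)) (sym (ℤP.+-assoc (f x) _ _))

∑-concatMap : ∀ (g : A → List B) xs f → ∑ (concatMap g xs) f ≡ ∑ xs (λ a → ∑ (g a) f)
∑-concatMap g []       f = refl
∑-concatMap g (x ∷ xs) f = trans (∑-++ (g x) _ f) (cong (_+_ (∑ (g x) f)) (∑-concatMap g xs f))

∑-zero : ∀ (xs : List A) {f} → (∀ a → f a ≡ + 0) → ∑ xs f ≡ + 0
∑-zero []       _   = refl
∑-zero (x ∷ xs) f≡0 = cong₂ _+_ (f≡0 x) (∑-zero xs f≡0)

∑-distrib-+ : ∀ (xs : List A) f g → ∑ xs (λ a → f a + g a) ≡ ∑ xs f + ∑ xs g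
∑-distrib-+ []       f g = refl
∑-distrib-+ (x ∷ xs) f g = trans (cong (_+_ (f x + g x)) (∑-distrib-+ xs f g))
  (+-CS.interchange (f x) (g x) (∑ xs f) (∑ xs g))

∑-distribˡ-* : ∀ (xs : List A) c f → ∑ xs (λ a → c * f a) ≡ c * ∑ xs f
∑-distribˡ-* []       c f = sym (ℤP.*-zeroʳ c)
∑-distribˡ-* (x ∷ xs) c f =
  trans (cong (_+_ (c * f x)) (∑-distribˡ-* xs c f)) (sym (ℤP.*-distribˡ-+ c (f x) _))

∑-comm : ∀ (xs : List A) (ys : List B) (f : A → B → ℤ) →
         ∑ xs (λ a → ∑ ys (f a)) ≡ ∑ ys (λ b → ∑ xs (λ a → f a b))
∑-comm []       ys f = sym (∑-zero ys (λ _ → refl))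
∑-comm (x ∷ xs) ys f =
  trans (cong (_+_ (∑ ys (f x))) (∑-comm xs ys f)) (sym (∑-distrib-+ ys (f x) _))

∑-filterᵇ : ∀ (p : A → Bool) xs f → ∑ (filterᵇ p xs) f ≡ ∑ xs (λ a → 𝟙 (p a) * f a)
∑-filterᵇ p []       f = refl
∑-filterᵇ p (x ∷ xs) f with p x
... | true  = cong₂ _+_ (sym (ℤP.*-identityˡ (f x))) (∑-filterᵇ p xs f)
... | false = trans (∑-filterᵇ p xs f) (sym (ℤP.+-identityˡ _))

∑-allFin-suc : ∀ k (q : Fin (suc k) → ℤ) → ∑ (allFin (suc k)) q ≡ q zero + ∑ (allFin k) (q ∘ suc)
∑-allFin-suc k q = cong (λ xs → q zero + foldr _+_ (+ 0) xs)
  (trans (map-tabulate suc q) (sym (map-tabulate id (q ∘ suc))))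

∑-allFin-single : ∀ {k} (q : Fin k → ℤ) b → (∀ a → a ≢ b → q a ≡ + 0) → ∑ (allFin k) q ≡ q b
∑-allFin-single {suc k} q zero    q≡0 = begin
  ∑ (allFin (suc k)) q              ≡⟨ ∑-allFin-suc k q ⟩
  q zero + ∑ (allFin k) (q ∘ suc)   ≡⟨ cong (_+_ (q zero)) (∑-zero (allFin k) (λ a → q≡0 (suc a) λ ())) ⟩
  q zero + + 0                      ≡⟨ ℤP.+-identityʳ (q zero) ⟩
  q zero                            ∎
  where open ≡-Reasoning
∑-allFin-single {suc k} q (suc b) q≡0 = begin
  ∑ (allFin (suc k)) q              ≡⟨ ∑-allFin-suc k q ⟩
  q zero + ∑ (allFin k) (q ∘ suc)   ≡⟨ cong₂ _+_ (q≡0 zero λ ()) (∑-allFin-single (q ∘ suc) b q∘suc≡0) ⟩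
  + 0 + q (suc b)                   ≡⟨ ℤP.+-identityˡ (q (suc b)) ⟩
  q (suc b)                         ∎
  where
  open ≡-Reasoning
  q∘suc≡0 : ∀ a → a ≢ b → q (suc a) ≡ + 0
  q∘suc≡0 a a≢b = q≡0 (suc a) (a≢b ∘ FinP.suc-injective)

∏ : ∀ k → (Fin k → ℤ) → ℤ
∏ k q = foldr (λ i r → q i * r) (+ 1) (allFin k)

∏-suc : ∀ k (q : Fin (suc k) → ℤ) → ∏ (suc k) q ≡ q zero * ∏ k (q ∘ suc)
∏-suc k q = cong (_*_ (q zero))
  (trans (cong (foldr (λ i r → q i * r) (+ 1)) (sym (map-tabulate id suc)))
         (foldr-map _ suc (+ 1) (allFin k)))

∏-cong : ∀ k {q r : Fin k → ℤ} → q ≗ r → ∏ k q ≡ ∏ k r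
∏-cong k q≗r = foldr-cong (λ i s → cong (_* s) (q≗r i)) refl (allFin k)

∏-distrib-* : ∀ k (q r : Fin k → ℤ) → ∏ k (λ i → q i * r i) ≡ ∏ k q * ∏ k r
∏-distrib-* zero    q r = refl
∏-distrib-* (suc k) q r = begin
  ∏ (suc k) (λ i → q i * r i)                         ≡⟨ ∏-suc k (λ i → q i * r i) ⟩
  q zero * r zero * ∏ k (λ i → q (suc i) * r (suc i)) ≡⟨ cong (_*_ (q zero * r zero))
                                                             (∏-distrib-* k (q ∘ suc) (r ∘ suc)) ⟩
  q zero * r zero * (∏ k (q ∘ suc) * ∏ k (r ∘ suc))   ≡⟨ *-CS.interchange (q zero) (r zero) _ _ ⟩
  q zero * ∏ k (q ∘ suc) * (r zero * ∏ k (r ∘ suc))   ≡⟨ sym (cong₂ _*_ (∏-suc k q) (∏-suc k r)) ⟩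
  ∏ (suc k) q * ∏ (suc k) r                           ∎
  where open ≡-Reasoning

∏-applyUpTo : ∀ (f : ℕ → ℤ) (g : ℕ → ℕ) k →
              foldr (λ i r → f i * r) (+ 1) (applyUpTo g k) ≡ ∏ k (λ i → f (g (toℕ i)))
∏-applyUpTo f g zero    = refl
∏-applyUpTo f g (suc k) = trans (cong (_*_ (f (g 0))) (∏-applyUpTo f (g ∘ suc) k))
                                (sym (∏-suc k (λ i → f (g (toℕ i)))))

∏[⋯]-∏ : ∀ a k (f : ℕ → ℤ) → ∏[ suc a ⋯ a ℕ.+ k ] f ≡ ∏ k (λ i → f (suc a ℕ.+ toℕ i))
∏[⋯]-∏ a k f rewrite ℕP.m+n∸m≡n a k =
  trans (cong (foldr (λ i r → f i * r) (+ 1)) (map-upTo (suc a ℕ.+_) k))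
        (∏-applyUpTo f (suc a ℕ.+_) k)

-- Without function extensionality a map occurs in allFuns only up to ≗, so reindexing a sum over
-- allFuns needs a summand that respects ≗.
Extensional : ∀ {n k} → ((Fin n → Fin k) → A) → Set
Extensional h = ∀ {f g} → f ≗ g → h f ≡ h g

cons-cong : ∀ {n k} (a : Fin k) {f g : Fin n → Fin k} → f ≗ g → cons a f ≗ cons a g
cons-cong a f≗g zero    = refl
cons-cong a f≗g (suc i) = f≗g i

allFuns-complete : ∀ n k (f : Fin n → Fin k) → Any (_≗ f) (allFuns n k)
allFuns-complete zero    k f = here (λ ())
allFuns-complete (suc n) k f =
  Anyₚ.concatMap⁺ _ (Any.map extend (allFuns-complete n k (f ∘ suc)))
  where
  extend : ∀ {g} → g ≗ f ∘ suc → Any (_≗ f) (map (λ a → cons a g) (allFin k))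
  extend g≗f∘suc = Anyₚ.map⁺ (Anyₚ.tabulate⁺ (f zero) λ { zero → refl ; (suc i) → g≗f∘suc i })

∑-allFuns-suc : ∀ n k (h : (Fin (suc n) → Fin k) → ℤ) →
                ∑ (allFuns (suc n) k) h ≡ ∑ (allFuns n k) (λ f → ∑ (allFin k) (λ a → h (cons a f)))
∑-allFuns-suc n k h = trans (∑-concatMap _ (allFuns n k) h)
  (∑-cong (allFuns n k) (λ f → cong (foldr _+_ (+ 0)) (sym (map-∘ (allFin k)))))

∑-allFuns-head : ∀ n k (h : (Fin (suc n) → Fin k) → ℤ) b →
                 (∀ a f → a ≢ b → h (cons a f) ≡ + 0) →
                 ∑ (allFuns (suc n) k) h ≡ ∑ (allFuns n k) (h ∘ cons b)
∑-allFuns-head n k h b h≡0 = trans (∑-allFuns-suc n k h)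
  (∑-cong (allFuns n k) (λ f → ∑-allFin-single (λ a → h (cons a f)) b (λ a a≢b → h≡0 a f a≢b)))

∑-allFuns-avoid-zero : ∀ n k (h : (Fin n → Fin (suc k)) → ℤ) → Extensional h →
                       (∀ f i → f i ≡ zero → h f ≡ + 0) →
                       ∑ (allFuns n (suc k)) h ≡ ∑ (allFuns n k) (λ g → h (suc ∘ g))
∑-allFuns-avoid-zero zero    k h h-ext h≡0 = cong (_+ + 0) (h-ext (λ ()))
∑-allFuns-avoid-zero (suc n) k h h-ext h≡0 = begin
  ∑ (allFuns (suc n) (suc k)) h
    ≡⟨ ∑-allFuns-suc n (suc k) h ⟩
  ∑ (allFuns n (suc k)) (λ f → ∑ (allFin (suc k)) (λ a → h (cons a f)))
    ≡⟨ ∑-cong (allFuns n (suc k)) drop-zero ⟩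
  ∑ (allFuns n (suc k)) (λ f → ∑ (allFin k) (λ a → h (cons (suc a) f)))
    ≡⟨ ∑-comm (allFuns n (suc k)) (allFin k) (λ f a → h (cons (suc a) f)) ⟩
  ∑ (allFin k) (λ a → ∑ (allFuns n (suc k)) (h ∘ cons (suc a)))
    ≡⟨ ∑-cong (allFin k) (λ a → ∑-allFuns-avoid-zero n k (h ∘ cons (suc a))
                                  (h-ext ∘ cons-cong (suc a)) (λ f i → h≡0 (cons (suc a) f) (suc i))) ⟩
  ∑ (allFin k) (λ a → ∑ (allFuns n k) (λ g → h (cons (suc a) (suc ∘ g))))
    ≡⟨ ∑-comm (allFin k) (allFuns n k) (λ a g → h (cons (suc a) (suc ∘ g))) ⟩
  ∑ (allFuns n k) (λ g → ∑ (allFin k) (λ a → h (cons (suc a) (suc ∘ g))))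
    ≡⟨ ∑-cong (allFuns n k) (λ g → ∑-cong (allFin k) (λ a → h-ext (suc∘cons a g))) ⟩
  ∑ (allFuns n k) (λ g → ∑ (allFin k) (λ a → h (suc ∘ cons a g)))
    ≡⟨ sym (∑-allFuns-suc n k (λ g → h (suc ∘ g))) ⟩
  ∑ (allFuns (suc n) k) (λ g → h (suc ∘ g))
    ∎
  where
  open ≡-Reasoning
  drop-zero : ∀ f → ∑ (allFin (suc k)) (λ a → h (cons a f)) ≡ ∑ (allFin k) (λ a → h (cons (suc a) f))
  drop-zero f = trans (∑-allFin-suc k (λ a → h (cons a f)))
    (trans (cong (_+ ∑ (allFin k) (λ a → h (cons (suc a) f))) (h≡0 (cons zero f) zero refl))
           (ℤP.+-identityˡ _))
  suc∘cons : ∀ a g → cons (suc a) (suc ∘ g) ≗ suc ∘ cons a g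
  suc∘cons a g zero    = refl
  suc∘cons a g (suc i) = refl

all-cong : ∀ {p q : A → Bool} → p ≗ q → ∀ xs → all p xs ≡ all q xs
all-cong p≗q xs = cong and (map-cong p≗q xs)

isPerm⇔injective : ∀ {k} (σ : Fun k) → T (isPerm σ) ⇔ Injective _≡_ _≡_ σ
isPerm⇔injective σ = mk⇔
  (λ perm {i} {j} → to (T-implies (σ i Fin.≟ σ j) (i Fin.≟ j))
                       (to (T-all-allFin _) (to (T-all-allFin _) perm i) j))
  (λ inj → from (T-all-allFin _) λ i → from (T-all-allFin _) λ j →
             from (T-implies (σ i Fin.≟ σ j) (i Fin.≟ j)) inj)

injective⇒surjective : ∀ {n} {f : Fin n → Fin n} → Injective _≡_ _≡_ f → ∀ b → ∃[ i ] f i ≡ b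
injective⇒surjective {suc n} {f} inj b with FinP.any? (λ i → f i Fin.≟ b)
... | yes hit  = hit
... | no  miss = contradiction (FinP.injective⇒≤ punchOut∘f-injective) ℕP.1+n≰n
  where
  b≢f : ∀ i → b ≢ f i
  b≢f i b≡fi = miss (i , sym b≡fi)
  punchOut∘f : Fin (suc n) → Fin n
  punchOut∘f i = punchOut (b≢f i)
  punchOut∘f-injective : Injective _≡_ _≡_ punchOut∘f
  punchOut∘f-injective {i} {j} eq = inj (FinP.punchOut-injective (b≢f i) (b≢f j) eq)

isPerm-ext : ∀ {k} → Extensional (isPerm {k})
isPerm-ext {k} f≗g = all-cong (λ i → all-cong (λ j →
  cong₂ (λ a b → not ⌊ a Fin.≟ b ⌋ ∨ ⌊ i Fin.≟ j ⌋) (f≗g i) (f≗g j)) (allFin k)) (allFin k)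

T-any-perms : ∀ {k} (p : Fun k → Bool) → Extensional p →
              T (any p (perms k)) ⇔ (∃[ σ ] T (isPerm σ) × T (p σ))
T-any-perms {k} p p-ext = mk⇔ witness present
  where
  witness : T (any p (perms k)) → ∃[ σ ] T (isPerm σ) × T (p σ)
  witness found with σ , σ∈perms , pσ ← find (Anyₚ.any⁻ p (perms k) found) =
    σ , proj₂ (∈-filter⁻ (T? ∘ isPerm) {xs = allFuns k k} σ∈perms) , pσ
  present : (∃[ σ ] T (isPerm σ) × T (p σ)) → T (any p (perms k))
  present (σ , perm , pσ) with g , g∈allFuns , g≗σ ← find (allFuns-complete k k σ) =
    Anyₚ.any⁺ p (lose (∈-filter⁺ (T? ∘ isPerm) g∈allFuns (subst T (sym (isPerm-ext g≗σ)) perm))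
                      (subst T (sym (p-ext g≗σ)) pσ))

-- F₀' and F₁' are images of F₀ and F₁ under a reduction σ ↦ τ (σ reduces to τ when `agrees σ`
-- holds everywhere).  If L τ reduces to τ and is the only member of S that does, then τ lies in the
-- image exactly when L τ lies in S.
preimage⇔lift : ∀ {k m} (S : Family m) → Extensional S →
                (L : Fun k → Fun m) (τ : Fun k) (agrees : Fun m → Fin k → Bool) →
                Extensional (λ σ → all (agrees σ) (allFin k)) →
                (∀ j → T (agrees (L τ) j)) →
                (Injective _≡_ _≡_ (L τ) → Injective _≡_ _≡_ τ) →
                (∀ σ → T (isPerm σ ∧ S σ) → (∀ j → T (agrees σ j)) → L τ ≗ σ) →
                T (isPerm τ ∧ any (λ σ → S σ ∧ all (agrees σ) (allFin k)) (perms m))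
                  ⇔ T (isPerm (L τ) ∧ S (L τ))
preimage⇔lift {k} S S-ext L τ agrees agrees-ext L-agrees L-inj⇒τ-inj L≗ = mk⇔ into back
  where
  matches : Fun _ → Bool
  matches σ = S σ ∧ all (agrees σ) (allFin k)
  matches-ext : Extensional matches
  matches-ext f≗g = cong₂ _∧_ (S-ext f≗g) (agrees-ext f≗g)
  into : T (isPerm τ ∧ any matches (perms _)) → T (isPerm (L τ) ∧ S (L τ))
  into τ∈S' with σ , σ-perm , σ-matches ← to (T-any-perms matches matches-ext) (proj₂ (to T-∧ τ∈S')) =
    let σ∈S , σ-agrees = to T-∧ σ-matches
        σ∈perm∧S = from T-∧ (σ-perm , σ∈S)
        Lτ≗σ = L≗ σ σ∈perm∧S (to (T-all-allFin (agrees σ)) σ-agrees)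
    in subst T (sym (cong₂ _∧_ (isPerm-ext Lτ≗σ) (S-ext Lτ≗σ))) σ∈perm∧S
  back : T (isPerm (L τ) ∧ S (L τ)) → T (isPerm τ ∧ any matches (perms _))
  back Lτ∈perm∧S =
    let Lτ-perm , Lτ∈S = to T-∧ Lτ∈perm∧S
        τ-inj = L-inj⇒τ-inj (to (isPerm⇔injective (L τ)) Lτ-perm)
        Lτ-agrees = from (T-all-allFin (agrees (L τ))) L-agrees
    in from T-∧ ( from (isPerm⇔injective τ) τ-inj
                , from (T-any-perms matches matches-ext) (L τ , Lτ-perm , from T-∧ (Lτ∈S , Lτ-agrees)))

lift₁ : ∀ {k} → Fun k → Fun (suc k)
lift₁ τ = cons zero (suc ∘ τ)

lift₂ : ∀ {k} → Fun k → Fun (suc (suc k))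
lift₂ τ = cons (suc zero) (cons zero (λ i → suc (suc (τ i))))

lift₁-injective⁻ : ∀ {k} (τ : Fun k) → Injective _≡_ _≡_ (lift₁ τ) → Injective _≡_ _≡_ τ
lift₁-injective⁻ τ inj {i} {j} eq = FinP.suc-injective (inj {suc i} {suc j} (cong suc eq))

lift₂-injective⁻ : ∀ {k} (τ : Fun k) → Injective _≡_ _≡_ (lift₂ τ) → Injective _≡_ _≡_ τ
lift₂-injective⁻ τ inj {i} {j} eq =
  FinP.suc-injective (FinP.suc-injective (inj {suc (suc i)} {suc (suc j)} (cong (λ a → suc (suc a)) eq)))

inverted : ∀ {k} → Fun k → Fin k → Fin k → ℕ
inverted σ i j = if (toℕ i <ᵇ toℕ j) ∧ (toℕ (σ j) <ᵇ toℕ (σ i)) then 1 else 0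

inversions-tabulate : ∀ {k} (σ : Fun k) →
                      inversions σ ≡ sum (tabulate (λ i → sum (tabulate (inverted σ i))))
inversions-tabulate {k} σ = trans
  (cong sum (map-cong (λ i → cong sum (map-tabulate id (inverted σ i))) (allFin k)))
  (cong sum (map-tabulate id (λ i → sum (tabulate (inverted σ i)))))

sum-tabulate-zero : ∀ k → sum (tabulate {n = k} (λ _ → 0)) ≡ 0
sum-tabulate-zero zero    = refl
sum-tabulate-zero (suc k) = sum-tabulate-zero k

inversions-lift₁ : ∀ {k} (τ : Fun k) → inversions (lift₁ τ) ≡ inversions τ
inversions-lift₁ {k} τ = begin
  inversions (lift₁ τ)                               ≡⟨ inversions-tabulate (lift₁ τ) ⟩
  sum (tabulate {n = k} (λ _ → 0)) ℕ.+ inversionsᵗ   ≡⟨ cong (ℕ._+ inversionsᵗ) (sum-tabulate-zero k) ⟩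
  inversionsᵗ                                        ≡⟨ inversions-tabulate τ ⟨
  inversions τ                                       ∎
  where
  open ≡-Reasoning
  inversionsᵗ = sum (tabulate (λ i → sum (tabulate (inverted τ i))))

inversions-lift₂ : ∀ {k} (τ : Fun k) → inversions (lift₂ τ) ≡ suc (inversions τ)
inversions-lift₂ {k} τ = begin
  inversions (lift₂ τ)
    ≡⟨ inversions-tabulate (lift₂ τ) ⟩
  suc (sum (tabulate {n = k} (λ _ → 0)) ℕ.+ (sum (tabulate {n = k} (λ _ → 0)) ℕ.+ inversionsᵗ))
    ≡⟨ cong₂ (λ a b → suc (a ℕ.+ (b ℕ.+ inversionsᵗ))) (sum-tabulate-zero k) (sum-tabulate-zero k) ⟩
  suc inversionsᵗ
    ≡⟨ cong suc (inversions-tabulate τ) ⟨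
  suc (inversions τ)
    ∎
  where
  open ≡-Reasoning
  inversionsᵗ = sum (tabulate (λ i → sum (tabulate (inverted τ i))))

sgn-lift₁ : ∀ {k} (τ : Fun k) → sgn (lift₁ τ) ≡ sgn τ
sgn-lift₁ τ = cong (_^_ (- (+ 1))) (inversions-lift₁ τ)

sgn-lift₂ : ∀ {k} (τ : Fun k) → sgn (lift₂ τ) ≡ - sgn τ
sgn-lift₂ τ = trans (cong (_^_ (- (+ 1))) (inversions-lift₂ τ)) (ℤP.-1*i≡-i (sgn τ))

monomial : ∀ k → ℤ → Fun k → ℤ
monomial k x σ = ∏ k (λ i → (x + + toℕ i) ^ toℕ (σ i))

-- The summand of P, so that P k S x ≡ ∑ (filterᵇ S (perms k)) (term k x) holds by refl.
term : ∀ k → ℤ → Fun k → ℤ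
term k x σ = sgn σ * monomial k x σ

monomial-translate : ∀ k x d (τ : Fun k) →
                     ∏ k (λ i → (x + + (d ℕ.+ toℕ i)) ^ toℕ (τ i)) ≡ monomial k (x + + d) τ
monomial-translate k x d τ = ∏-cong k λ i → cong (_^ toℕ (τ i))
  (trans (cong (_+_ x) (ℤP.pos-+ d (toℕ i))) (sym (ℤP.+-assoc x (+ d) (+ toℕ i))))

monomial-lift₁ : ∀ k x (τ : Fun k) →
                 monomial (suc k) x (lift₁ τ) ≡ ∏ k (λ i → x + + suc (toℕ i)) * monomial k (x + + 1) τ
monomial-lift₁ k x τ = begin
  monomial (suc k) x (lift₁ τ)                    ≡⟨ ∏-suc k (λ i → (x + + toℕ i) ^ toℕ (lift₁ τ i)) ⟩
  + 1 * ∏ k (λ i → a i * a i ^ toℕ (τ i))          ≡⟨ ℤP.*-identityˡ _ ⟩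
  ∏ k (λ i → a i * a i ^ toℕ (τ i))                ≡⟨ ∏-distrib-* k a (λ i → a i ^ toℕ (τ i)) ⟩
  ∏ k a * ∏ k (λ i → a i ^ toℕ (τ i))              ≡⟨ cong (_*_ (∏ k a)) (monomial-translate k x 1 τ) ⟩
  ∏ k a * monomial k (x + + 1) τ                  ∎
  where
  open ≡-Reasoning
  a : Fin k → ℤ
  a i = x + + suc (toℕ i)

monomial-lift₂ : ∀ k x (τ : Fun k) →
                 monomial (suc (suc k)) x (lift₂ τ)
                   ≡ x * ∏ k (λ i → (x + + (2 ℕ.+ toℕ i)) ^ 2) * monomial k (x + + 2) τ
monomial-lift₂ k x τ = begin
  monomial (suc (suc k)) x (lift₂ τ)
    ≡⟨ ∏-suc (suc k) (λ i → (x + + toℕ i) ^ toℕ (lift₂ τ i)) ⟩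
  (x + + 0) ^ 1 * ∏ (suc k) (λ i → (x + + suc (toℕ i)) ^ toℕ (lift₂ τ (suc i)))
    ≡⟨ cong₂ _*_ (trans (ℤP.^-identityʳ (x + + 0)) (ℤP.+-identityʳ x))
                 (∏-suc k (λ i → (x + + suc (toℕ i)) ^ toℕ (lift₂ τ (suc i)))) ⟩
  x * (+ 1 * ∏ k (λ i → a i ^ (2 ℕ.+ toℕ (τ i))))
    ≡⟨ cong (_*_ x) (ℤP.*-identityˡ _) ⟩
  x * ∏ k (λ i → a i ^ (2 ℕ.+ toℕ (τ i)))
    ≡⟨ cong (_*_ x) (∏-cong k (λ i → ℤP.^-distribˡ-+-* (a i) 2 (toℕ (τ i)))) ⟩
  x * ∏ k (λ i → a i ^ 2 * a i ^ toℕ (τ i))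
    ≡⟨ cong (_*_ x) (∏-distrib-* k (λ i → a i ^ 2) (λ i → a i ^ toℕ (τ i))) ⟩
  x * (∏ k (λ i → a i ^ 2) * ∏ k (λ i → a i ^ toℕ (τ i)))
    ≡⟨ sym (ℤP.*-assoc x _ _) ⟩
  x * ∏ k (λ i → a i ^ 2) * ∏ k (λ i → a i ^ toℕ (τ i))
    ≡⟨ cong (_*_ (x * ∏ k (λ i → a i ^ 2))) (monomial-translate k x 2 τ) ⟩
  x * ∏ k (λ i → a i ^ 2) * monomial k (x + + 2) τ
    ∎
  where
  open ≡-Reasoning
  a : Fin k → ℤ
  a i = x + + (2 ℕ.+ toℕ i)

term-lift₁ : ∀ k x (τ : Fun k) →
             term (suc k) x (lift₁ τ) ≡ ∏ k (λ i → x + + suc (toℕ i)) * term k (x + + 1) τ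
term-lift₁ k x τ = trans (cong₂ _*_ (sgn-lift₁ τ) (monomial-lift₁ k x τ))
  (*-CS.x∙yz≈y∙xz (sgn τ) (∏ k (λ i → x + + suc (toℕ i))) (monomial k (x + + 1) τ))

term-lift₂ : ∀ k x (τ : Fun k) →
             term (suc (suc k)) x (lift₂ τ)
               ≡ - (x * ∏ k (λ i → (x + + (2 ℕ.+ toℕ i)) ^ 2)) * term k (x + + 2) τ
term-lift₂ k x τ = begin
  term (suc (suc k)) x (lift₂ τ)    ≡⟨ cong₂ _*_ (sgn-lift₂ τ) (monomial-lift₂ k x τ) ⟩
  - sgn τ * (c * monomial k x' τ)   ≡⟨ *-CS.x∙yz≈y∙xz (- sgn τ) c (monomial k x' τ) ⟩
  c * (- sgn τ * monomial k x' τ)   ≡⟨ cong (_*_ c) (ℤP.neg-distribˡ-* (sgn τ) _) ⟨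
  c * - term k x' τ                 ≡⟨ ℤP.neg-distribʳ-* c _ ⟨
  - (c * term k x' τ)               ≡⟨ ℤP.neg-distribˡ-* c _ ⟩
  - c * term k x' τ                 ∎
  where
  open ≡-Reasoning
  x' = x + + 2
  c  = x * ∏ k (λ i → (x + + (2 ℕ.+ toℕ i)) ^ 2)

inversions-ext : ∀ {k} → Extensional (inversions {k})
inversions-ext {k} f≗g = cong sum (map-cong (λ i → cong sum (map-cong (λ j →
  cong₂ (λ a b → if (toℕ i <ᵇ toℕ j) ∧ (toℕ a <ᵇ toℕ b) then 1 else 0) (f≗g j) (f≗g i))
  (allFin k))) (allFin k))

term-ext : ∀ k x → Extensional (term k x)
term-ext k x f≗g = cong₂ _*_ (cong (_^_ (- (+ 1))) (inversions-ext f≗g))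
  (∏-cong k (λ i → cong (λ a → (x + + toℕ i) ^ toℕ a) (f≗g i)))

P-summand : ∀ k → Family k → ℤ → Fun k → ℤ
P-summand k S x σ = 𝟙 (isPerm σ ∧ S σ) * term k x σ

P-as-∑ : ∀ k (S : Family k) x → P k S x ≡ ∑ (allFuns k k) (P-summand k S x)
P-as-∑ k S x = begin
  P k S x
    ≡⟨ ∑-filterᵇ S (perms k) (term k x) ⟩
  ∑ (perms k) (λ σ → 𝟙 (S σ) * term k x σ)
    ≡⟨ ∑-filterᵇ isPerm (allFuns k k) (λ σ → 𝟙 (S σ) * term k x σ) ⟩
  ∑ (allFuns k k) (λ σ → 𝟙 (isPerm σ) * (𝟙 (S σ) * term k x σ))
    ≡⟨ ∑-cong (allFuns k k) regroup ⟩
  ∑ (allFuns k k) (P-summand k S x)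
    ∎
  where
  open ≡-Reasoning
  regroup : ∀ σ → 𝟙 (isPerm σ) * (𝟙 (S σ) * term k x σ) ≡ P-summand k S x σ
  regroup σ = trans (sym (ℤP.*-assoc (𝟙 (isPerm σ)) (𝟙 (S σ)) (term k x σ)))
                    (cong (_* term k x σ) (sym (𝟙-∧ (isPerm σ) (S σ))))

P-split : ∀ k (S S₀ S₁ : Family k) x →
          (∀ σ → 𝟙 (isPerm σ ∧ S σ) ≡ 𝟙 (isPerm σ ∧ S₀ σ) + 𝟙 (isPerm σ ∧ S₁ σ)) →
          P k S x ≡ P k S₀ x + P k S₁ x
P-split k S S₀ S₁ x split = begin
  P k S x
    ≡⟨ P-as-∑ k S x ⟩
  ∑ (allFuns k k) (P-summand k S x)
    ≡⟨ ∑-cong (allFuns k k) summand-split ⟩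
  ∑ (allFuns k k) (λ σ → P-summand k S₀ x σ + P-summand k S₁ x σ)
    ≡⟨ ∑-distrib-+ (allFuns k k) (P-summand k S₀ x) (P-summand k S₁ x) ⟩
  ∑ (allFuns k k) (P-summand k S₀ x) + ∑ (allFuns k k) (P-summand k S₁ x)
    ≡⟨ cong₂ _+_ (P-as-∑ k S₀ x) (P-as-∑ k S₁ x) ⟨
  P k S₀ x + P k S₁ x
    ∎
  where
  open ≡-Reasoning
  summand-split : ∀ σ → P-summand k S x σ ≡ P-summand k S₀ x σ + P-summand k S₁ x σ
  summand-split σ = trans (cong (_* term k x σ) (split σ))
    (ℤP.*-distribʳ-+ (term k x σ) (𝟙 (isPerm σ ∧ S₀ σ)) (𝟙 (isPerm σ ∧ S₁ σ)))

∑-lift₁ : ∀ k (h : Fun (suc k) → ℤ) → Extensional h →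
          (∀ σ → ¬ (σ zero ≡ zero × Injective _≡_ _≡_ σ) → h σ ≡ + 0) →
          ∑ (allFuns (suc k) (suc k)) h ≡ ∑ (allFuns k k) (h ∘ lift₁)
∑-lift₁ k h h-ext h≡0 = begin
  ∑ (allFuns (suc k) (suc k)) h
    ≡⟨ ∑-allFuns-head k (suc k) h zero (λ a f a≢0 → h≡0 (cons a f) (a≢0 ∘ proj₁)) ⟩
  ∑ (allFuns k (suc k)) (h ∘ cons zero)
    ≡⟨ ∑-allFuns-avoid-zero k k (h ∘ cons zero) (h-ext ∘ cons-cong zero) hits-zero-twice ⟩
  ∑ (allFuns k k) (h ∘ lift₁)
    ∎
  where
  open ≡-Reasoning
  hits-zero-twice : ∀ f i → f i ≡ zero → h (cons zero f) ≡ + 0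
  hits-zero-twice f i fi≡0 = h≡0 (cons zero f) λ (_ , inj) → FinP.0≢1+n (sym (inj {suc i} {zero} fi≡0))

∑-lift₂ : ∀ k (h : Fun (suc (suc k)) → ℤ) → Extensional h →
          (∀ σ → ¬ (σ zero ≡ suc zero × σ (suc zero) ≡ zero × Injective _≡_ _≡_ σ) → h σ ≡ + 0) →
          ∑ (allFuns (suc (suc k)) (suc (suc k))) h ≡ ∑ (allFuns k k) (h ∘ lift₂)
∑-lift₂ k h h-ext h≡0 = begin
  ∑ (allFuns (suc (suc k)) (suc (suc k))) h
    ≡⟨ ∑-allFuns-head (suc k) _ h (suc zero) (λ a f a≢1 → h≡0 (cons a f) (a≢1 ∘ proj₁)) ⟩
  ∑ (allFuns (suc k) (suc (suc k))) (h ∘ cons (suc zero))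
    ≡⟨ ∑-allFuns-head k _ (h ∘ cons (suc zero)) zero
         (λ a f a≢0 → h≡0 (cons (suc zero) (cons a f)) (a≢0 ∘ proj₁ ∘ proj₂)) ⟩
  ∑ (allFuns k (suc (suc k))) (λ r → h (cons (suc zero) (cons zero r)))
    ≡⟨ ∑-allFuns-avoid-zero k (suc k) _ (h-ext ∘ cons-cong (suc zero) ∘ cons-cong zero) hits-zero-twice ⟩
  ∑ (allFuns k (suc k)) (λ r → h (cons (suc zero) (cons zero (suc ∘ r))))
    ≡⟨ ∑-allFuns-avoid-zero k k _ (λ r≗s → h-ext (cons-cong (suc zero) (cons-cong zero (cong suc ∘ r≗s))))
         hits-one-twice ⟩
  ∑ (allFuns k k) (h ∘ lift₂)
    ∎
  where
  open ≡-Reasoning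
  hits-zero-twice : ∀ r i → r i ≡ zero → h (cons (suc zero) (cons zero r)) ≡ + 0
  hits-zero-twice r i ri≡0 = h≡0 _ λ (_ , _ , inj) →
    FinP.0≢1+n (sym (FinP.suc-injective (inj {suc (suc i)} {suc zero} ri≡0)))
  hits-one-twice : ∀ r i → r i ≡ zero → h (cons (suc zero) (cons zero (suc ∘ r))) ≡ + 0
  hits-one-twice r i ri≡0 = h≡0 _ λ (_ , _ , inj) →
    FinP.0≢1+n (sym (inj {suc (suc i)} {zero} (cong suc ri≡0)))

P-summand-ext : ∀ k (S : Family k) x → Extensional S → Extensional (P-summand k S x)
P-summand-ext k S x S-ext f≗g =
  cong₂ (λ b y → 𝟙 b * y) (cong₂ _∧_ (isPerm-ext f≗g) (S-ext f≗g)) (term-ext k x f≗g)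

P-lift₁ : ∀ k (S : Family (suc k)) (S' : Family k) x → Extensional S →
          (∀ σ → T (isPerm σ ∧ S σ) → σ zero ≡ zero) →
          (∀ τ → T (isPerm τ ∧ S' τ) ⇔ T (isPerm (lift₁ τ) ∧ S (lift₁ τ))) →
          P (suc k) S x ≡ ∏[ 1 ⋯ k ] (λ i → x + + i) * P k S' (x + + 1)
P-lift₁ k S S' x S-ext fixes-zero S'⇔S∘lift₁ = begin
  P (suc k) S x
    ≡⟨ P-as-∑ (suc k) S x ⟩
  ∑ (allFuns (suc k) (suc k)) (P-summand (suc k) S x)
    ≡⟨ ∑-lift₁ k (P-summand (suc k) S x) (P-summand-ext (suc k) S x S-ext) outside ⟩
  ∑ (allFuns k k) (P-summand (suc k) S x ∘ lift₁)
    ≡⟨ ∑-cong (allFuns k k) reindex ⟩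
  ∑ (allFuns k k) (λ τ → c * P-summand k S' (x + + 1) τ)
    ≡⟨ ∑-distribˡ-* (allFuns k k) c (P-summand k S' (x + + 1)) ⟩
  c * ∑ (allFuns k k) (P-summand k S' (x + + 1))
    ≡⟨ cong₂ _*_ (∏[⋯]-∏ 0 k (λ i → x + + i)) (P-as-∑ k S' (x + + 1)) ⟨
  ∏[ 1 ⋯ k ] (λ i → x + + i) * P k S' (x + + 1)
    ∎
  where
  open ≡-Reasoning
  c = ∏ k (λ i → x + + suc (toℕ i))
  outside : ∀ σ → ¬ (σ zero ≡ zero × Injective _≡_ _≡_ σ) → P-summand (suc k) S x σ ≡ + 0
  outside σ = 𝟙-*-vanishes (term (suc k) x σ) λ σ∈S →
    fixes-zero σ σ∈S , to (isPerm⇔injective σ) (proj₁ (to T-∧ σ∈S))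
  reindex : ∀ τ → P-summand (suc k) S x (lift₁ τ) ≡ c * P-summand k S' (x + + 1) τ
  reindex τ = trans (cong₂ _*_ (cong 𝟙 (sym (T-⇔→≡ (S'⇔S∘lift₁ τ)))) (term-lift₁ k x τ))
    (*-CS.x∙yz≈y∙xz (𝟙 (isPerm τ ∧ S' τ)) c (term k (x + + 1) τ))

P-lift₂ : ∀ k (S : Family (suc (suc k))) (S' : Family k) x → Extensional S →
          (∀ σ → T (isPerm σ ∧ S σ) → σ zero ≡ suc zero × σ (suc zero) ≡ zero) →
          (∀ τ → T (isPerm τ ∧ S' τ) ⇔ T (isPerm (lift₂ τ) ∧ S (lift₂ τ))) →
          P (suc (suc k)) S x ≡ - (x * ∏[ 2 ⋯ suc k ] (λ i → (x + + i) ^ 2)) * P k S' (x + + 2)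
P-lift₂ k S S' x S-ext swaps-01 S'⇔S∘lift₂ = begin
  P (suc (suc k)) S x
    ≡⟨ P-as-∑ (suc (suc k)) S x ⟩
  ∑ (allFuns (suc (suc k)) (suc (suc k))) (P-summand (suc (suc k)) S x)
    ≡⟨ ∑-lift₂ k (P-summand (suc (suc k)) S x) (P-summand-ext (suc (suc k)) S x S-ext) outside ⟩
  ∑ (allFuns k k) (P-summand (suc (suc k)) S x ∘ lift₂)
    ≡⟨ ∑-cong (allFuns k k) reindex ⟩
  ∑ (allFuns k k) (λ τ → - c * P-summand k S' (x + + 2) τ)
    ≡⟨ ∑-distribˡ-* (allFuns k k) (- c) (P-summand k S' (x + + 2)) ⟩
  - c * ∑ (allFuns k k) (P-summand k S' (x + + 2))
    ≡⟨ cong₂ (λ p q → - (x * p) * q) (∏[⋯]-∏ 1 k (λ i → (x + + i) ^ 2)) (P-as-∑ k S' (x + + 2)) ⟨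
  - (x * ∏[ 2 ⋯ suc k ] (λ i → (x + + i) ^ 2)) * P k S' (x + + 2)
    ∎
  where
  open ≡-Reasoning
  c = x * ∏ k (λ i → (x + + (2 ℕ.+ toℕ i)) ^ 2)
  outside : ∀ σ → ¬ (σ zero ≡ suc zero × σ (suc zero) ≡ zero × Injective _≡_ _≡_ σ) →
            P-summand (suc (suc k)) S x σ ≡ + 0
  outside σ = 𝟙-*-vanishes (term (suc (suc k)) x σ) λ σ∈S →
    let σ₀≡1 , σ₁≡0 = swaps-01 σ σ∈S in σ₀≡1 , σ₁≡0 , to (isPerm⇔injective σ) (proj₁ (to T-∧ σ∈S))
  reindex : ∀ τ → P-summand (suc (suc k)) S x (lift₂ τ) ≡ - c * P-summand k S' (x + + 2) τ
  reindex τ = trans (cong₂ _*_ (cong 𝟙 (sym (T-⇔→≡ (S'⇔S∘lift₂ τ)))) (term-lift₂ k x τ))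
    (*-CS.x∙yz≈y∙xz (𝟙 (isPerm τ ∧ S' τ)) (- c) (term k (x + + 2) τ))

𝟙-∧-partition : ∀ a b c₀ c₁ → (T b → T c₀ ⊎ T c₁) → ¬ (T c₀ × T c₁) →
                𝟙 (a ∧ b) ≡ 𝟙 (a ∧ a ∧ b ∧ c₀) + 𝟙 (a ∧ a ∧ b ∧ c₁)
𝟙-∧-partition false _     _     _     _     _        = refl
𝟙-∧-partition true  false _     _     _     _        = refl
𝟙-∧-partition true  true  true  true  _     disjoint = contradiction _ disjoint
𝟙-∧-partition true  true  true  false _     _        = refl
𝟙-∧-partition true  true  false true  _     _        = refl
𝟙-∧-partition true  true  false false cover _        = ⊥-elim (reduce (cover _))

T-∧₃ : ∀ {a b c} → T (a ∧ b ∧ c) → T a × T b × T c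
T-∧₃ {true} {true} {true} _ = _ , _ , _

toℕ-≡ᵇ⇒≡ : ∀ {k} {i j : Fin k} → T (toℕ i ≡ᵇ toℕ j) → i ≡ j
toℕ-≡ᵇ⇒≡ = FinP.toℕ-injective ∘ ℕP.≡ᵇ⇒≡ _ _

banded-ext : ∀ {m} → Extensional (banded {m})
banded-ext {m} f≗g = all-cong (λ i → cong (λ a → ℕ.∣ toℕ a - toℕ i ∣ ℕ.≤ᵇ 1) (f≗g i)) (allFin m)

banded-at : ∀ {m} (σ : Fun m) → T (banded σ) → ∀ i → T (ℕ.∣ toℕ (σ i) - toℕ i ∣ ℕ.≤ᵇ 1)
banded-at σ = to (T-all-allFin (λ i → ℕ.∣ toℕ (σ i) - toℕ i ∣ ℕ.≤ᵇ 1))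

banded-head : ∀ {m} (σ : Fun (suc (suc m))) → T (banded σ) → σ zero ≡ zero ⊎ σ zero ≡ suc zero
banded-head σ σ-banded with σ zero | banded-at σ σ-banded zero
... | zero        | _ = inj₁ refl
... | suc zero    | _ = inj₂ refl
... | suc (suc _) | ()

banded-swap : ∀ {m} (σ : Fun (suc (suc m))) → Injective _≡_ _≡_ σ → T (banded σ) →
              σ zero ≡ suc zero → σ (suc zero) ≡ zero
banded-swap σ inj σ-banded σ₀≡1 with injective⇒surjective inj zero
... | zero        , σ₀≡0 = contradiction (trans (sym σ₀≡1) σ₀≡0) λ ()
... | suc zero    , σ₁≡0 = σ₁≡0
... | suc (suc j) , σⱼ≡0 = contradiction (subst (T ∘ near) σⱼ≡0 (banded-at σ σ-banded (suc (suc j)))) λ ()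
  where
  near : Fin _ → Bool
  near a = ℕ.∣ toℕ a - toℕ (suc (suc j)) ∣ ℕ.≤ᵇ 1

F-ext : ∀ {m} ρ t → Extensional (F {m} ρ t)
F-ext {m} ρ t f≗g = cong₂ _∧_ (banded-ext f≗g)
  (cong (λ w → ⌊ + w ℤ.≟ t ⌋) (cong sum (map-cong (λ i → cong (toℕ ∘ ρ i) (f≗g i)) (allFin m))))

lift₁-≗ : ∀ {k} (σ : Fun (suc k)) (τ : Fun k) → Injective _≡_ _≡_ σ → σ zero ≡ zero →
          (∀ j → toℕ (τ j) ≡ toℕ (σ (suc j)) ∸ 1) → lift₁ τ ≗ σ
lift₁-≗ σ τ inj σ₀≡0 τ≡σ∘suc-1 zero    = sym σ₀≡0
lift₁-≗ σ τ inj σ₀≡0 τ≡σ∘suc-1 (suc j) with σ (suc j) in eq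
... | zero  = contradiction (inj (trans eq (sym σ₀≡0))) λ ()
... | suc a = cong suc (FinP.toℕ-injective (trans (τ≡σ∘suc-1 j) (cong (λ b → toℕ b ∸ 1) eq)))

lift₂-≗ : ∀ {k} (σ : Fun (suc (suc k))) (τ : Fun k) → Injective _≡_ _≡_ σ →
          σ zero ≡ suc zero → σ (suc zero) ≡ zero →
          (∀ j → toℕ (τ j) ≡ toℕ (σ (suc (suc j))) ∸ 2) → lift₂ τ ≗ σ
lift₂-≗ σ τ inj σ₀≡1 σ₁≡0 τ≡σ∘suc²-2 zero          = sym σ₀≡1
lift₂-≗ σ τ inj σ₀≡1 σ₁≡0 τ≡σ∘suc²-2 (suc zero)    = sym σ₁≡0
lift₂-≗ σ τ inj σ₀≡1 σ₁≡0 τ≡σ∘suc²-2 (suc (suc j)) with σ (suc (suc j)) in eq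
... | zero        = contradiction (inj (trans eq (sym σ₁≡0))) λ ()
... | suc zero    = contradiction (inj (trans eq (sym σ₀≡1))) λ ()
... | suc (suc a) =
  cong (λ b → suc (suc b)) (FinP.toℕ-injective (trans (τ≡σ∘suc²-2 j) (cong (λ b → toℕ b ∸ 2) eq)))

module _ (n : ℕ) (ρ : Fin (suc (suc n)) → Fin (suc (suc n)) → Fin 2) (t : ℤ) where

  F₀-ext : Extensional (F₀ n ρ t)
  F₀-ext f≗g =
    cong₂ _∧_ (isPerm-ext f≗g) (cong₂ _∧_ (F-ext ρ t f≗g) (cong (λ a → toℕ a ≡ᵇ 0) (f≗g zero)))

  F₁-ext : Extensional (F₁ n ρ t)
  F₁-ext f≗g =
    cong₂ _∧_ (isPerm-ext f≗g) (cong₂ _∧_ (F-ext ρ t f≗g) (cong (λ a → toℕ a ≡ᵇ 1) (f≗g zero)))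

  𝟙-F-split : ∀ σ → 𝟙 (isPerm σ ∧ F ρ t σ) ≡ 𝟙 (isPerm σ ∧ F₀ n ρ t σ) + 𝟙 (isPerm σ ∧ F₁ n ρ t σ)
  𝟙-F-split σ = 𝟙-∧-partition (isPerm σ) (F ρ t σ) _ _ cover disjoint
    where
    cover : T (F ρ t σ) → T (toℕ (σ zero) ≡ᵇ 0) ⊎ T (toℕ (σ zero) ≡ᵇ 1)
    cover σ∈F with banded-head σ (proj₁ (to T-∧ σ∈F))
    ... | inj₁ σ₀≡0 = inj₁ (ℕP.≡⇒≡ᵇ _ _ (cong toℕ σ₀≡0))
    ... | inj₂ σ₀≡1 = inj₂ (ℕP.≡⇒≡ᵇ _ _ (cong toℕ σ₀≡1))
    disjoint : ¬ (T (toℕ (σ zero) ≡ᵇ 0) × T (toℕ (σ zero) ≡ᵇ 1))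
    disjoint (is0 , is1) =
      ℕP.0≢1+n (trans (sym (ℕP.≡ᵇ⇒≡ (toℕ (σ zero)) 0 is0)) (ℕP.≡ᵇ⇒≡ (toℕ (σ zero)) 1 is1))

  F-member : ∀ σ {c} → T (isPerm σ ∧ isPerm σ ∧ F ρ t σ ∧ c) → T (isPerm σ) × T (F ρ t σ) × T c
  F-member σ = T-∧₃ {isPerm σ} {F ρ t σ} ∘ proj₂ ∘ to (T-∧ {isPerm σ})

  F₀-fixes-zero : ∀ σ → T (isPerm σ ∧ F₀ n ρ t σ) → σ zero ≡ zero
  F₀-fixes-zero σ = toℕ-≡ᵇ⇒≡ ∘ proj₂ ∘ proj₂ ∘ F-member σ

  F₁-swaps-01 : ∀ σ → T (isPerm σ ∧ F₁ n ρ t σ) → σ zero ≡ suc zero × σ (suc zero) ≡ zero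
  F₁-swaps-01 σ σ∈F₁ =
    let perm , σ∈F , σ₀≡ᵇ1 = F-member σ σ∈F₁
        σ₀≡1 = toℕ-≡ᵇ⇒≡ σ₀≡ᵇ1
    in σ₀≡1 , banded-swap σ (to (isPerm⇔injective σ) perm) (proj₁ (to T-∧ σ∈F)) σ₀≡1

  F₀'⇔F₀∘lift₁ : ∀ τ → T (isPerm τ ∧ F₀' n ρ t τ) ⇔ T (isPerm (lift₁ τ) ∧ F₀ n ρ t (lift₁ τ))
  F₀'⇔F₀∘lift₁ τ = preimage⇔lift (F₀ n ρ t) F₀-ext lift₁ τ agrees agrees-ext
    (λ j → ℕP.≡⇒≡ᵇ (toℕ (τ j)) _ refl) (lift₁-injective⁻ τ) lift₁τ≗
    where
    agrees : Fun (suc (suc n)) → Fin (suc n) → Bool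
    agrees σ j = toℕ (τ j) ≡ᵇ (toℕ (σ (suc j)) ∸ 1)
    agrees-ext : Extensional (λ σ → all (agrees σ) (allFin (suc n)))
    agrees-ext f≗g =
      all-cong (λ j → cong (λ a → toℕ (τ j) ≡ᵇ (toℕ a ∸ 1)) (f≗g (suc j))) (allFin (suc n))
    lift₁τ≗ : ∀ σ → T (isPerm σ ∧ F₀ n ρ t σ) → (∀ j → T (agrees σ j)) → lift₁ τ ≗ σ
    lift₁τ≗ σ σ∈F₀ σ-agrees = lift₁-≗ σ τ (to (isPerm⇔injective σ) (proj₁ (to T-∧ σ∈F₀)))
      (F₀-fixes-zero σ σ∈F₀) (λ j → ℕP.≡ᵇ⇒≡ _ _ (σ-agrees j))

  F₁'⇔F₁∘lift₂ : ∀ τ → T (isPerm τ ∧ F₁' n ρ t τ) ⇔ T (isPerm (lift₂ τ) ∧ F₁ n ρ t (lift₂ τ))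
  F₁'⇔F₁∘lift₂ τ = preimage⇔lift (F₁ n ρ t) F₁-ext lift₂ τ agrees agrees-ext
    (λ j → ℕP.≡⇒≡ᵇ (toℕ (τ j)) _ refl) (lift₂-injective⁻ τ) lift₂τ≗
    where
    agrees : Fun (suc (suc n)) → Fin n → Bool
    agrees σ j = toℕ (τ j) ≡ᵇ (toℕ (σ (suc (suc j))) ∸ 2)
    agrees-ext : Extensional (λ σ → all (agrees σ) (allFin n))
    agrees-ext f≗g =
      all-cong (λ j → cong (λ a → toℕ (τ j) ≡ᵇ (toℕ a ∸ 2)) (f≗g (suc (suc j)))) (allFin n)
    lift₂τ≗ : ∀ σ → T (isPerm σ ∧ F₁ n ρ t σ) → (∀ j → T (agrees σ j)) → lift₂ τ ≗ σ
    lift₂τ≗ σ σ∈F₁ σ-agrees =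
      let σ₀≡1 , σ₁≡0 = F₁-swaps-01 σ σ∈F₁
      in lift₂-≗ σ τ (to (isPerm⇔injective σ) (proj₁ (to T-∧ σ∈F₁))) σ₀≡1 σ₁≡0
                 (λ j → ℕP.≡ᵇ⇒≡ _ _ (σ-agrees j))

proposition5p6 : (n : ℕ) (ρ : Fin (suc (suc n)) → Fin (suc (suc n)) → Fin 2) (t : ℤ) →
    Σ (Fun (suc (suc n))) (λ σ → (isPerm σ ≡ true) × (F ρ t σ ≡ true)) →
    (x : ℤ) →
    P (suc (suc n)) (F ρ t) x
      ≡ ∏[ 1 ⋯ suc n ] (λ i → x + + i) * P (suc n) (F₀' n ρ t) (x + + 1)
        - x * ∏[ 2 ⋯ suc n ] (λ i → (x + + i) ^ 2) * P n (F₁' n ρ t) (x + + 2)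
proposition5p6 n ρ t _ x = begin
  P (suc (suc n)) (F ρ t) x
    ≡⟨ P-split (suc (suc n)) (F ρ t) (F₀ n ρ t) (F₁ n ρ t) x (𝟙-F-split n ρ t) ⟩
  P (suc (suc n)) (F₀ n ρ t) x + P (suc (suc n)) (F₁ n ρ t) x
    ≡⟨ cong₂ _+_
         (P-lift₁ (suc n) (F₀ n ρ t) (F₀' n ρ t) x
                  (F₀-ext n ρ t) (F₀-fixes-zero n ρ t) (F₀'⇔F₀∘lift₁ n ρ t))
         (P-lift₂ n (F₁ n ρ t) (F₁' n ρ t) x
                  (F₁-ext n ρ t) (F₁-swaps-01 n ρ t) (F₁'⇔F₁∘lift₂ n ρ t)) ⟩
  c₀ * P (suc n) (F₀' n ρ t) (x + + 1) + - (x * c₁) * P n (F₁' n ρ t) (x + + 2)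
    ≡⟨ cong (_+_ (c₀ * P (suc n) (F₀' n ρ t) (x + + 1))) (ℤP.neg-distribˡ-* (x * c₁) _) ⟨
  c₀ * P (suc n) (F₀' n ρ t) (x + + 1) - x * c₁ * P n (F₁' n ρ t) (x + + 2)
    ∎
  where
  open ≡-Reasoning
  c₀ = ∏[ 1 ⋯ suc n ] (λ i → x + + i)
  c₁ = ∏[ 2 ⋯ suc n ] (λ i → (x + + i) ^ 2)
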